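{- Let $T\subset S_3$ with $|T|=5$ and let $\tau\in S_4$. Then for all $n\ge3$, $|S_n(T\cup\{\tau\})|=1$ in the following cases: (1) if $321\notin T$ and $\tau\neq4321$, then $S_n(T\cup\{\tau\})=\{(n,n-1,\dots,1)\}$; (2) if $123\notin T$ and $\tau\neq1234$, then $S_n(T\cup\{\tau\})=\{(1,2,\dots,n)\}$.
   Context: Permutations are written in one-line notation. For $\pi\in S_n$ and $\sigma\in S_k$, $\pi$ contains $\sigma$ if there are indices $1\le i_1<\dots<i_k\le n$ such that $(\pi_{i_1},\dots,\pi_{i_k})$ is order-isomorphic to $\sigma$ (i.e. $\pi_{i_a}<\pi_{i_b}$ iff $\sigma_a<\sigma_b$); otherwise $\pi$ avoids $\sigma$. For a set $A$ of permutations, $S_n(A)$ denotes the set of permutations in $S_n$ avoiding every element of $A$. -}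

module Defs where

open import Data.Nat using (ℕ)
open import Data.Fin using (Fin; opposite) renaming (_<_ to _<ᶠ_)
open import Data.Vec using (Vec; lookup; tabulate; allFin)
open import Data.List using (List)
open import Data.List.Relation.Unary.All using (All)
open import Data.Product using (Σ; _×_)
open import Function.Definitions using (Injective)
open import Function.Bundles using (_⇔_)
open import Relation.Binary.PropositionalEquality using (_≡_)
open import Relation.Nullary using (¬_)

-- A permutation in S_n, in one-line notation: a vector (π₁,…,πₙ) of
-- values in {0,…,n-1} (0-based) whose entries are pairwise distinct.
record Perm (n : ℕ) : Set where
  constructor perm
  field
    vec : Vec (Fin n) n
    inj : Injective _≡_ _≡_ (lookup vec)

open Perm public

StrictlyIncreasing : ∀ {k n} → (Fin k → Fin n) → Set
StrictlyIncreasing e = ∀ a b → a <ᶠ b → e a <ᶠ e b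

Contains : ∀ {n k} → Perm n → Perm k → Set
Contains {n} {k} π σ =
  Σ (Fin k → Fin n) λ e →
    StrictlyIncreasing e ×
    (∀ a b → (lookup (vec π) (e a) <ᶠ lookup (vec π) (e b)) ⇔ (lookup (vec σ) a <ᶠ lookup (vec σ) b))

Avoids : ∀ {n k} → Perm n → Perm k → Set
Avoids π σ = ¬ Contains π σ

AvoidsAll : ∀ {n} → Perm n → List (Perm 3) → Perm 4 → Set
AvoidsAll π T τ = All (Avoids π) T × Avoids π τ

incr : (n : ℕ) → Vec (Fin n) n
incr n = allFin n

decr : (n : ℕ) → Vec (Fin n) n
decr n = tabulate opposite

-- Five distinct patterns of length 3 omitting the monotone pattern μ (321 or 123) are all of S₃
-- except μ, so a permutation avoiding them has no 3-pattern other than μ. For n ≥ 3 every pair of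
-- positions lies in a 3-subsequence, hence every pair of entries is ordered as in μ and the
-- permutation is monotone. Conversely a monotone permutation only contains monotone patterns, so it
-- avoids T (which omits μ) and τ (which is not monotone).
module Submission where

open import Defs
open import Data.Nat using (ℕ; _≤_)
open import Data.List using (List; length; map)
open import Data.List.Membership.Propositional using (_∉_)
open import Data.List.Relation.Unary.Unique.Propositional using (Unique)
open import Data.Product using (_×_)
open import Function.Bundles using (_⇔_)
open import Relation.Binary.PropositionalEquality using (_≡_; _≢_)

import Data.Nat as ℕ
import Data.Nat.Properties as ℕ
open import Data.Nat using (s≤s)
open import Data.Fin using (Fin; suc; toℕ; fromℕ<; opposite; inject₁; punchOut; _<_; _<?_)
open import Data.Fin.Patterns using (0F; 1F; 2F)
open import Data.Fin.Properties
  using (toℕ-injective; toℕ-fromℕ<; toℕ-inject₁; toℕ<n; ≤̄⇒inject₁<; ≤-refl; opposite-prop;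
         opposite-involutive; punchOut-injective; injective⇒≤; <-cmp; <-irrefl; <-asym; <-trans; <⇒≢;
         all?)
  renaming (_≟_ to _≟ᶠ_)
open import Data.Fin.Subset using (Subset; ∣_∣; ⊤; _⊂_) renaming (_∈_ to _∈ₛ_; _∉_ to _∉ₛ_)
open import Data.Fin.Subset.Properties using (p⊂q⇒∣p∣<∣q∣; ∣⊤∣≡n; ∈⊤)
open import Data.Vec using (Vec; []; _∷_; lookup; tabulate)
open import Data.Vec.Properties
  using (lookup∘tabulate; tabulate∘lookup; tabulate-cong; lookup⇒[]=; []=⇒lookup; lookup-allFin)
  renaming (≡-dec to ≡-dec-Vec)
import Data.List as List
open import Data.List using ([]; _∷_)
open import Data.List.Properties using (length-map)
open import Data.List.Relation.Unary.All as All using (All)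
open import Data.List.Relation.Unary.AllPairs using (_∷_)
open import Data.List.Relation.Unary.Any using (index; here; there)
open import Data.List.Relation.Unary.Any.Properties using (lookup-index)
open import Data.List.Membership.Propositional using (_∈_)
open import Data.List.Membership.Propositional.Properties using (∈-lookup; ∈-map⁺; ∈-map⁻)
open import Data.List.Membership.DecPropositional (≡-dec-Vec {n = 3} (_≟ᶠ_ {3})) using (_∈?_)
open import Data.List.Relation.Binary.Subset.Propositional using (_⊆_)
open import Data.Product using (Σ; ∃-syntax; _,_)
open import Function using (_∘_; id)
open import Function.Definitions using (Injective)
open import Function.Bundles using (mk⇔; Equivalence)
open import Relation.Binary.Definitions using (tri<; tri≈; tri>)
open import Relation.Nullary using (does; ¬_; contradiction)
open import Relation.Nullary.Decidable using (dec-true; dec-false; decidable-stable; from-yes; _→-dec_)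
open import Relation.Binary.PropositionalEquality
  using (refl; sym; trans; cong; subst; subst₂; module ≡-Reasoning)

private
  variable
    k m n : ℕ

injective-missing⇒< : {f : Fin m → Fin n} {x : Fin n} →
                      Injective _≡_ _≡_ f → (∀ i → x ≢ f i) → m ℕ.< n
injective-missing⇒< {n = ℕ.suc n} f-injective x≢f =
  s≤s (injective⇒≤ λ {i} {j} eq → f-injective (punchOut-injective (x≢f i) (x≢f j) eq))

injective-missing-two⇒< : {f : Fin m → Fin n} {x y : Fin n} → Injective _≡_ _≡_ f → x ≢ y →
                          (∀ i → x ≢ f i) → (∀ i → y ≢ f i) → ℕ.suc m ℕ.< n
injective-missing-two⇒< {n = ℕ.suc n} f-injective x≢y x≢f y≢f =
  s≤s (injective-missing⇒< {x = punchOut x≢y}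
        (λ {i} {j} eq → f-injective (punchOut-injective (x≢f i) (x≢f j) eq))
        (λ i eq → y≢f i (punchOut-injective x≢y (x≢f i) eq)))

unique⇒lookup-injective : {A : Set} {xs : List A} → Unique xs → Injective _≡_ _≡_ (List.lookup xs)
unique⇒lookup-injective {xs = _ ∷ _} _          {0F}    {0F}    _  = refl
unique⇒lookup-injective {xs = _ ∷ _} (x∉xs ∷ _) {0F}    {suc j} eq =
  contradiction eq (All.lookup x∉xs (∈-lookup j))
unique⇒lookup-injective {xs = _ ∷ _} (x∉xs ∷ _) {suc i} {0F}    eq =
  contradiction (sym eq) (All.lookup x∉xs (∈-lookup i))
unique⇒lookup-injective {xs = _ ∷ _} (_ ∷ xs!)  {suc i} {suc j} eq =
  cong suc (unique⇒lookup-injective xs! eq)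

unique-missing-two⇒< : {A : Set} {xs ys : List A} {x y : A} → Unique xs → xs ⊆ ys →
                       x ∈ ys → y ∈ ys → x ≢ y → x ∉ xs → y ∉ xs → ℕ.suc (length xs) ℕ.< length ys
unique-missing-two⇒< {xs = xs} {ys} xs! xs⊆ys x∈ys y∈ys x≢y x∉xs y∉xs =
  injective-missing-two⇒< position-injective (x≢y ∘ index-injective x∈ys y∈ys)
    (missing x∈ys x∉xs) (missing y∈ys y∉xs)
  where
  index-injective : ∀ {u v} (p : u ∈ ys) (q : v ∈ ys) → index p ≡ index q → u ≡ v
  index-injective p q eq =
    trans (lookup-index p) (trans (cong (List.lookup ys) eq) (sym (lookup-index q)))

  position : Fin (length xs) → Fin (length ys)
  position i = index (xs⊆ys (∈-lookup i))

  position-injective : Injective _≡_ _≡_ position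
  position-injective eq = unique⇒lookup-injective xs! (index-injective _ _ eq)

  missing : ∀ {u} (p : u ∈ ys) → u ∉ xs → ∀ i → index p ≢ position i
  missing p u∉xs i eq = u∉xs (subst (_∈ xs) (sym (index-injective p _ eq)) (∈-lookup i))

opposite-< : {i j : Fin n} → i < j → opposite j < opposite i
opposite-< {n = ℕ.suc n} {i} {j} i<j =
  subst₂ ℕ._<_ (sym (opposite-prop j)) (sym (opposite-prop i)) (ℕ.∸-monoʳ-< (s≤s i<j) (toℕ<n j))

strictlyIncreasing⇒toℕ≤ : (f : Fin n → Fin m) → StrictlyIncreasing f → ∀ i → toℕ i ≤ toℕ (f i)
strictlyIncreasing⇒toℕ≤ f inc 0F      = ℕ.z≤n
strictlyIncreasing⇒toℕ≤ f inc (suc i) =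
  ℕ.≤-trans (s≤s (strictlyIncreasing⇒toℕ≤ (f ∘ inject₁) (λ a b → inc _ _ ∘ inject₁-< a b) i))
            (inc (inject₁ i) (suc i) (≤̄⇒inject₁< ≤-refl))
  where
  inject₁-< : ∀ (a b : Fin _) → a < b → inject₁ a < inject₁ b
  inject₁-< a b = subst₂ ℕ._<_ (sym (toℕ-inject₁ a)) (sym (toℕ-inject₁ b))

strictlyIncreasing⇒≗id : (f : Fin n → Fin n) → StrictlyIncreasing f → ∀ i → f i ≡ i
strictlyIncreasing⇒≗id f inc i =
  toℕ-injective (ℕ.≤-antisym (ℕ.≮⇒≥ i≮fi) (strictlyIncreasing⇒toℕ≤ f inc i))
  where
  -- The upper bound f i ≤ i is the lower bound for the conjugate opposite ∘ f ∘ opposite.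
  i≮fi : ¬ (i < f i)
  i≮fi i<fi = ℕ.<⇒≱ (opposite-< i<fi)
    (subst (λ j → toℕ (opposite i) ≤ toℕ (opposite (f j))) (opposite-involutive i)
      (strictlyIncreasing⇒toℕ≤ (opposite ∘ f ∘ opposite)
        (λ a b → opposite-< ∘ inc _ _ ∘ opposite-<) (opposite i)))

module _ {w : Fin k → Fin m} {r : Fin k → Fin n} (w-injective : Injective _≡_ _≡_ w)
         (<-preserving : ∀ a b → w a < w b → r a < r b) where

  <-preserving⇒injective : Injective _≡_ _≡_ r
  <-preserving⇒injective {a} {b} ra≡rb with <-cmp (w a) (w b)
  ... | tri< wa<wb _ _ = contradiction ra≡rb (<⇒≢ (<-preserving a b wa<wb))
  ... | tri≈ _ wa≡wb _ = w-injective wa≡wb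
  ... | tri> _ _ wb<wa = contradiction (sym ra≡rb) (<⇒≢ (<-preserving b a wb<wa))

  <-preserving⇒<-reflecting : ∀ a b → r a < r b → w a < w b
  <-preserving⇒<-reflecting a b ra<rb with <-cmp (w a) (w b)
  ... | tri< wa<wb _ _ = wa<wb
  ... | tri≈ _ wa≡wb _ = contradiction (cong r (w-injective wa≡wb)) (<⇒≢ ra<rb)
  ... | tri> _ _ wb<wa = contradiction ra<rb (<-asym (<-preserving b a wb<wa))

strictlyIncreasing⇒injective : (e : Fin k → Fin n) → StrictlyIncreasing e → Injective _≡_ _≡_ e
strictlyIncreasing⇒injective e = <-preserving⇒injective id

data Direction : Set where
  ascending descending : Direction

Ordered : Direction → Fin n → Fin n → Set
Ordered ascending  x y = x < y
Ordered descending x y = y < x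

Monotone : Direction → (Fin k → Fin n) → Set
Monotone d f = ∀ a b → a < b → Ordered d (f a) (f b)

monotone : Direction → (n : ℕ) → Vec (Fin n) n
monotone ascending  = incr
monotone descending = decr

strictlyDecreasing⇒≗opposite : (f : Fin n → Fin n) → Monotone descending f → ∀ i → f i ≡ opposite i
strictlyDecreasing⇒≗opposite f dec i = begin
  f i                       ≡⟨ opposite-involutive (f i) ⟨
  opposite (opposite (f i)) ≡⟨ cong opposite (strictlyIncreasing⇒≗id (opposite ∘ f)
                                                 (λ a b → opposite-< ∘ dec a b) i) ⟩
  opposite i                ∎
  where open ≡-Reasoning

monotone-Monotone : ∀ d → Monotone d (lookup (monotone d n))
monotone-Monotone ascending  a b     = subst₂ _<_ (sym (lookup-allFin a)) (sym (lookup-allFin b))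
monotone-Monotone descending a b a<b =
  subst₂ _<_ (sym (lookup∘tabulate opposite b)) (sym (lookup∘tabulate opposite a)) (opposite-< a<b)

Monotone⇒≡monotone : ∀ d (v : Vec (Fin n) n) → Monotone d (lookup v) → v ≡ monotone d n
Monotone⇒≡monotone ascending  v inc =
  trans (sym (tabulate∘lookup v)) (tabulate-cong (strictlyIncreasing⇒≗id (lookup v) inc))
Monotone⇒≡monotone descending v dec =
  trans (sym (tabulate∘lookup v)) (tabulate-cong (strictlyDecreasing⇒≗opposite (lookup v) dec))

OrderIsomorphic : (Fin k → Fin m) → (Fin k → Fin n) → Set
OrderIsomorphic x y = ∀ a b → (x a < x b) ⇔ (y a < y b)

<-preserving⇒OrderIsomorphic : {w : Fin k → Fin m} {r : Fin k → Fin n} → Injective _≡_ _≡_ w →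
                               (∀ a b → w a < w b → r a < r b) → OrderIsomorphic w r
<-preserving⇒OrderIsomorphic w-injective <-preserving a b =
  mk⇔ (<-preserving a b) (<-preserving⇒<-reflecting w-injective <-preserving a b)

Ordered-cong : ∀ d {x : Fin k → Fin m} {y : Fin k → Fin n} → OrderIsomorphic x y →
               ∀ a b → Ordered d (x a) (x b) ⇔ Ordered d (y a) (y b)
Ordered-cong ascending  iso a b = iso a b
Ordered-cong descending iso a b = iso b a

Contains-resp-vec : (π : Perm n) {σ ρ : Perm k} → vec σ ≡ vec ρ → Contains π σ → Contains π ρ
Contains-resp-vec π σ≡ρ (e , inc , iso) =
  e , inc , subst (λ v → OrderIsomorphic (lookup (vec π) ∘ e) (lookup v)) σ≡ρ iso

contained⇒∉ : (π : Perm n) {T : List (Perm k)} → All (Avoids π) T →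
              (σ : Perm k) → Contains π σ → vec σ ∉ map vec T
contained⇒∉ π avoids σ π⊇σ σ∈T with ∈-map⁻ vec σ∈T
... | t , t∈T , σ≡t = All.lookup avoids t∈T (Contains-resp-vec π {σ} {t} σ≡t π⊇σ)

Monotone-contained : ∀ d (π : Perm n) (σ : Perm k) → Contains π σ →
                     Monotone d (lookup (vec π)) → Monotone d (lookup (vec σ))
Monotone-contained d π σ (e , inc , iso) π-monotone a b a<b =
  Equivalence.to (Ordered-cong d iso a b) (π-monotone (e a) (e b) (inc a b a<b))

contained-in-monotone : ∀ d (π : Perm n) → vec π ≡ monotone d n →
                        (σ : Perm k) → Contains π σ → vec σ ≡ monotone d k
contained-in-monotone d π π≡ σ π⊇σ = Monotone⇒≡monotone d (vec σ)
  (Monotone-contained d π σ π⊇σ (subst (λ v → Monotone d (lookup v)) (sym π≡) (monotone-Monotone d)))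

module Standardisation (w : Fin k → Fin n) (w-injective : Injective _≡_ _≡_ w) where

  below : Fin k → Subset k
  below a = tabulate λ b → does (w b <? w a)

  ∈-below⁺ : ∀ {a b} → w b < w a → b ∈ₛ below a
  ∈-below⁺ {a} {b} wb<wa =
    lookup⇒[]= b (below a) (trans (lookup∘tabulate _ b) (dec-true (w b <? w a) wb<wa))

  ∈-below⁻ : ∀ {a b} → b ∈ₛ below a → w b < w a
  ∈-below⁻ {a} {b} b∈below = decidable-stable (w b <? w a) λ wb≮wa →
    contradiction (trans (sym ([]=⇒lookup b∈below))
                         (trans (lookup∘tabulate _ b) (dec-false (w b <? w a) wb≮wa)))
                  λ ()

  ∉-below : ∀ a → a ∉ₛ below a
  ∉-below a a∈below = <-irrefl refl (∈-below⁻ a∈below)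

  below⊂⊤ : ∀ a → below a ⊂ ⊤
  below⊂⊤ a = (λ _ → ∈⊤) , a , ∈⊤ , ∉-below a

  below-⊂ : ∀ {a b} → w a < w b → below a ⊂ below b
  below-⊂ {a} wa<wb =
    (λ c∈below → ∈-below⁺ (<-trans (∈-below⁻ c∈below) wa<wb)) , a , ∈-below⁺ wa<wb , ∉-below a

  rank : Fin k → Fin k
  rank a = fromℕ< (subst (∣ below a ∣ ℕ.<_) (∣⊤∣≡n _) (p⊂q⇒∣p∣<∣q∣ (below⊂⊤ a)))

  rank-< : ∀ a b → w a < w b → lookup (tabulate rank) a < lookup (tabulate rank) b
  rank-< a b wa<wb = subst₂ _<_ (sym (lookup∘tabulate rank a)) (sym (lookup∘tabulate rank b))
    (subst₂ ℕ._<_ (sym (toℕ-fromℕ< _)) (sym (toℕ-fromℕ< _)) (p⊂q⇒∣p∣<∣q∣ (below-⊂ wa<wb)))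

  standardise : Perm k
  standardise = perm (tabulate rank) (<-preserving⇒injective w-injective rank-<)

  standardise-OrderIsomorphic : OrderIsomorphic w (lookup (vec standardise))
  standardise-OrderIsomorphic = <-preserving⇒OrderIsomorphic w-injective rank-<

open Standardisation using (standardise; standardise-OrderIsomorphic)

subsequence-injective : (π : Perm n) (e : Fin k → Fin n) → StrictlyIncreasing e →
                        Injective _≡_ _≡_ (lookup (vec π) ∘ e)
subsequence-injective π e inc = strictlyIncreasing⇒injective e inc ∘ inj π

patternAt : (π : Perm n) (e : Fin k → Fin n) → StrictlyIncreasing e → Perm k
patternAt π e inc = standardise (lookup (vec π) ∘ e) (subsequence-injective π e inc)

patternAt-OrderIsomorphic : (π : Perm n) (e : Fin k → Fin n) (inc : StrictlyIncreasing e) →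
                            OrderIsomorphic (lookup (vec π) ∘ e) (lookup (vec (patternAt π e inc)))
patternAt-OrderIsomorphic π e inc = standardise-OrderIsomorphic _ (subsequence-injective π e inc)

triple-increasing : {x y z : Fin n} → x < y → y < z → StrictlyIncreasing (lookup (x ∷ y ∷ z ∷ []))
triple-increasing x<y y<z 0F 1F _ = x<y
triple-increasing x<y y<z 0F 2F _ = <-trans x<y y<z
triple-increasing x<y y<z 1F 2F _ = y<z
triple-increasing _   _   0F 0F ()
triple-increasing _   _   1F 0F ()
triple-increasing _   _   1F 1F (s≤s ())
triple-increasing _   _   2F 0F ()
triple-increasing _   _   2F 1F (s≤s ())
triple-increasing _   _   2F 2F (s≤s (s≤s ()))

pair-in-triple : {i j : Fin (3 ℕ.+ m)} → i < j →
                 Σ (Fin 3 → Fin (3 ℕ.+ m)) λ e → StrictlyIncreasing e ×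
                   ∃[ a ] ∃[ b ] a < b × e a ≡ i × e b ≡ j
pair-in-triple {i = 0F}    {1F}          _   =
  _ , triple-increasing {z = 2F} (s≤s ℕ.z≤n) (s≤s (s≤s ℕ.z≤n)) , 0F , 1F , s≤s ℕ.z≤n , refl , refl
pair-in-triple {i = 0F}    {suc (suc j)} _   =
  _ , triple-increasing {y = 1F} (s≤s ℕ.z≤n) (s≤s (s≤s ℕ.z≤n)) , 0F , 2F , s≤s ℕ.z≤n , refl , refl
pair-in-triple {i = suc i}               i<j =
  _ , triple-increasing {x = 0F} (s≤s ℕ.z≤n) i<j , 1F , 2F , s≤s (s≤s ℕ.z≤n) , refl , refl

Monotone-from-patterns : ∀ d (π : Perm (3 ℕ.+ m)) →
                         (∀ σ → Contains π σ → vec σ ≡ monotone d 3) → Monotone d (lookup (vec π))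
Monotone-from-patterns d π patterns-monotone i j i<j with pair-in-triple i<j
... | e , inc , a , b , a<b , ea≡i , eb≡j =
  subst₂ (λ x y → Ordered d (lookup (vec π) x) (lookup (vec π) y)) ea≡i eb≡j
    (Equivalence.from (Ordered-cong d (patternAt-OrderIsomorphic π e inc) a b) (σ-monotone a b a<b))
  where
  σ-monotone : Monotone d (lookup (vec (patternAt π e inc)))
  σ-monotone = subst (λ v → Monotone d (lookup v))
    (sym (patterns-monotone (patternAt π e inc) (e , inc , patternAt-OrderIsomorphic π e inc)))
    (monotone-Monotone d)

S₃ : List (Vec (Fin 3) 3)
S₃ = (0F ∷ 1F ∷ 2F ∷ []) ∷ (2F ∷ 1F ∷ 0F ∷ []) ∷ (0F ∷ 2F ∷ 1F ∷ []) ∷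
     (1F ∷ 0F ∷ 2F ∷ []) ∷ (1F ∷ 2F ∷ 0F ∷ []) ∷ (2F ∷ 0F ∷ 1F ∷ []) ∷ []

monotone∈S₃ : ∀ d → monotone d 3 ∈ S₃
monotone∈S₃ ascending  = here refl
monotone∈S₃ descending = there (here refl)

∈-S₃ : (σ : Perm 3) → vec σ ∈ S₃
∈-S₃ (perm (a ∷ b ∷ c ∷ []) σ-injective) = injective⇒∈S₃ a b c (λ i j → σ-injective {i} {j})
  where
  -- Decided by evaluation over all 27 triples.
  injective⇒∈S₃ : ∀ a b c →
                  (∀ i j → lookup (a ∷ b ∷ c ∷ []) i ≡ lookup (a ∷ b ∷ c ∷ []) j → i ≡ j) →
                  (a ∷ b ∷ c ∷ []) ∈ S₃
  injective⇒∈S₃ = from-yes (all? λ a → all? λ b → all? λ c →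
    (all? λ i → all? λ j → (lookup (a ∷ b ∷ c ∷ []) i ≟ᶠ lookup (a ∷ b ∷ c ∷ []) j) →-dec (i ≟ᶠ j))
      →-dec ((a ∷ b ∷ c ∷ []) ∈? S₃))

S₃-missing-one : (T : List (Perm 3)) → length T ≡ 5 → Unique (map vec T) → {u v : Vec (Fin 3) 3} →
                 u ∈ S₃ → v ∈ S₃ → u ∉ map vec T → v ∉ map vec T → u ≡ v
S₃-missing-one T |T|≡5 T! {u} {v} u∈S₃ v∈S₃ u∉T v∉T =
  decidable-stable (≡-dec-Vec _≟ᶠ_ u v) λ u≢v →
    ℕ.<-irrefl refl (subst (λ l → ℕ.suc l ℕ.< 6) (trans (length-map vec T) |T|≡5)
      (unique-missing-two⇒< T! T⊆S₃ u∈S₃ v∈S₃ u≢v u∉T v∉T))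
  where
  T⊆S₃ : map vec T ⊆ S₃
  T⊆S₃ w∈T with ∈-map⁻ vec w∈T
  ... | t , _ , refl = ∈-S₃ t

only-monotone-avoids : ∀ d (T : List (Perm 3)) → length T ≡ 5 → Unique (map vec T) → (τ : Perm 4) →
                       3 ≤ n → monotone d 3 ∉ map vec T → vec τ ≢ monotone d 4 →
                       (π : Perm n) → AvoidsAll π T τ ⇔ (vec π ≡ monotone d n)
only-monotone-avoids {n = ℕ.suc (ℕ.suc (ℕ.suc _))} d T |T|≡5 T! τ (s≤s (s≤s (s≤s _))) μ∉T τ≢μ π =
  mk⇔ (λ (avoids , _) → Monotone⇒≡monotone d (vec π) (Monotone-from-patterns d π λ σ π⊇σ →
         S₃-missing-one T |T|≡5 T! (∈-S₃ σ) (monotone∈S₃ d) (contained⇒∉ π avoids σ π⊇σ) μ∉T))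
      (λ π≡μ → All.tabulate (λ {t} t∈T π⊇t →
                 μ∉T (subst (_∈ map vec T) (contained-in-monotone d π π≡μ t π⊇t) (∈-map⁺ vec t∈T)))
             , τ≢μ ∘ contained-in-monotone d π π≡μ τ)

theorem5p3 : (T : List (Perm 3)) → length T ≡ 5 → Unique (map vec T) → (τ : Perm 4) →
    (n : ℕ) → 3 ≤ n →
      ((decr 3 ∉ map vec T) → vec τ ≢ decr 4 → (π : Perm n) → AvoidsAll π T τ ⇔ (vec π ≡ decr n))
      × ((incr 3 ∉ map vec T) → vec τ ≢ incr 4 → (π : Perm n) → AvoidsAll π T τ ⇔ (vec π ≡ incr n))
theorem5p3 T |T|≡5 T! τ n 3≤n =
  only-monotone-avoids descending T |T|≡5 T! τ 3≤n , only-monotone-avoids ascending T |T|≡5 T! τ 3≤n
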